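{- Let $m\ge 1$ and $q=3^m$. Suppose $P_i=(x_i,c_ix_i^2)\in\mathbb{F}_q^2$ for $i=1,2,3$, where $x_i,c_i\in\mathbb{F}_q$ are all nonzero, the points $P_1,P_2,P_3$ are distinct, and $P_1+P_2+P_3=0$. Then $-(c_1c_2+c_1c_3+c_2c_3)$ is a square in $\mathbb{F}_q$. -}

module Defs where

open import Level using (Level; _⊔_)
open import Data.Nat using (ℕ)
open import Data.Fin using (Fin)
open import Data.Product using (∃; _×_)
open import Relation.Nullary using (¬_)
open import Relation.Binary.PropositionalEquality using (_≡_)
open import Algebra.Bundles using (CommutativeRing)

record IsFiniteFieldOfOrder {c ℓ : Level} (q : ℕ) (F : CommutativeRing c ℓ) : Set (c ⊔ ℓ) where
  open CommutativeRing F
  field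
    0≉1     : ¬ (0# ≈ 1#)
    inverse : ∀ x → ¬ (x ≈ 0#) → ∃ λ y → x * y ≈ 1#
    enum    : Fin q → Carrier
    enum-surjective : ∀ x → ∃ λ i → enum i ≈ x
    enum-injective  : ∀ i j → enum i ≈ enum j → i ≡ j

IsSquare : {c ℓ : Level} (F : CommutativeRing c ℓ) → CommutativeRing.Carrier F → Set (c ⊔ ℓ)
IsSquare F x = ∃ λ y → y * y ≈ x
  where open CommutativeRing F

{-# OPTIONS --safe #-}
-- Substituting x₃ = -(x₁ + x₂) into c₁x₁² + c₂x₂² + c₃x₃² = 0 gives the binary
-- quadratic form c₁x₁² + c₂x₂² + c₃(x₁ + x₂)² = 0, and multiplying it by
-- c₁ + c₃ completes the square:
--   ((c₁ + c₃)x₁ + c₃x₂)² + (c₁c₂ + c₁c₃ + c₂c₃)x₂² = 0.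
-- Dividing by x₂² exhibits -(c₁c₂ + c₁c₃ + c₂c₃) as a square.
module Submission where

open import Defs
open import Level using (Level)
open import Data.Nat using (ℕ; _≤_; _^_)
open import Data.Product using (_×_; _,_)
open import Relation.Nullary using (¬_)
open import Algebra.Bundles using (CommutativeRing)

module _ {c ℓ : Level} (F : CommutativeRing c ℓ) where
  open CommutativeRing F
  open import Algebra.Properties.Group +-group using (inverseˡ-unique; inverseʳ-unique; ⁻¹-involutive)
  open import Algebra.Properties.Ring ring using (-‿distribˡ-*; -‿distribʳ-*)
  open import Relation.Binary.Reasoning.Setoid setoid
  open import Algebra.Solver.Ring.NaturalCoefficients.Default commutativeSemiring
    using (solve; _:+_; _:*_; _:=_)

  -x*-x≈x*x : ∀ x → (- x) * (- x) ≈ x * x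
  -x*-x≈x*x x = begin
    (- x) * (- x)  ≈⟨ -‿distribˡ-* x (- x) ⟨
    - (x * - x)    ≈⟨ -‿cong (-‿distribʳ-* x x) ⟨
    - - (x * x)    ≈⟨ ⁻¹-involutive (x * x) ⟩
    x * x          ∎

  x+y+z≈0⇒z*z≈[x+y]*[x+y] : ∀ {x y z} → x + y + z ≈ 0# → z * z ≈ (x + y) * (x + y)
  x+y+z≈0⇒z*z≈[x+y]*[x+y] {x} {y} {z} x+y+z≈0 = begin
    z * z                  ≈⟨ *-cong z≈-[x+y] z≈-[x+y] ⟩
    - (x + y) * - (x + y)  ≈⟨ -x*-x≈x*x (x + y) ⟩
    (x + y) * (x + y)      ∎
    where
    z≈-[x+y] : z ≈ - (x + y)
    z≈-[x+y] = inverseʳ-unique (x + y) z x+y+z≈0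

  completing-square : ∀ x₁ x₂ c₁ c₂ c₃ →
    ((c₁ + c₃) * x₁ + c₃ * x₂) * ((c₁ + c₃) * x₁ + c₃ * x₂)
      + (c₁ * c₂ + c₁ * c₃ + c₂ * c₃) * (x₂ * x₂)
    ≈ (c₁ + c₃) * (c₁ * (x₁ * x₁) + c₂ * (x₂ * x₂) + c₃ * ((x₁ + x₂) * (x₁ + x₂)))
  completing-square = solve 5 (λ x₁ x₂ c₁ c₂ c₃ →
    ((c₁ :+ c₃) :* x₁ :+ c₃ :* x₂) :* ((c₁ :+ c₃) :* x₁ :+ c₃ :* x₂)
      :+ (c₁ :* c₂ :+ c₁ :* c₃ :+ c₂ :* c₃) :* (x₂ :* x₂)
    := (c₁ :+ c₃) :* (c₁ :* (x₁ :* x₁) :+ c₂ :* (x₂ :* x₂) :+ c₃ :* ((x₁ :+ x₂) :* (x₁ :+ x₂)))) refl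

  completed-square≈0 : ∀ {x₁ x₂ x₃} c₁ c₂ c₃ →
    x₁ + x₂ + x₃ ≈ 0# →
    c₁ * (x₁ * x₁) + c₂ * (x₂ * x₂) + c₃ * (x₃ * x₃) ≈ 0# →
    ((c₁ + c₃) * x₁ + c₃ * x₂) * ((c₁ + c₃) * x₁ + c₃ * x₂)
      + (c₁ * c₂ + c₁ * c₃ + c₂ * c₃) * (x₂ * x₂) ≈ 0#
  completed-square≈0 {x₁} {x₂} {x₃} c₁ c₂ c₃ Σx≈0 Σcx²≈0 = begin
    _                                                                 ≈⟨ completing-square x₁ x₂ c₁ c₂ c₃ ⟩
    (c₁ + c₃) * (c₁ * (x₁ * x₁) + c₂ * (x₂ * x₂) + c₃ * ((x₁ + x₂) * (x₁ + x₂)))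
      ≈⟨ *-congˡ (+-congˡ (*-congˡ (sym (x+y+z≈0⇒z*z≈[x+y]*[x+y] Σx≈0)))) ⟩
    (c₁ + c₃) * (c₁ * (x₁ * x₁) + c₂ * (x₂ * x₂) + c₃ * (x₃ * x₃))  ≈⟨ *-congˡ Σcx²≈0 ⟩
    (c₁ + c₃) * 0#                                                    ≈⟨ zeroʳ (c₁ + c₃) ⟩
    0#                                                                ∎

  a²+eb²≈0⇒-e-isSquare : ∀ a b e {b⁻¹} → b * b⁻¹ ≈ 1# →
    a * a + e * (b * b) ≈ 0# → IsSquare F (- e)
  a²+eb²≈0⇒-e-isSquare a b e {b⁻¹} b*b⁻¹≈1 a²+eb²≈0 =
    a * b⁻¹ , inverseˡ-unique ((a * b⁻¹) * (a * b⁻¹)) e [ab⁻¹]²+e≈0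
    where
    [ab⁻¹]²+e≈0 : (a * b⁻¹) * (a * b⁻¹) + e ≈ 0#
    [ab⁻¹]²+e≈0 = begin
      (a * b⁻¹) * (a * b⁻¹) + e                           ≈⟨ +-congˡ (sym (*-identityʳ e)) ⟩
      (a * b⁻¹) * (a * b⁻¹) + e * 1#                      ≈⟨ +-congˡ (*-congˡ (sym (*-identityʳ 1#))) ⟩
      (a * b⁻¹) * (a * b⁻¹) + e * (1# * 1#)               ≈⟨ +-congˡ (*-congˡ (sym (*-cong b*b⁻¹≈1 b*b⁻¹≈1))) ⟩
      (a * b⁻¹) * (a * b⁻¹) + e * ((b * b⁻¹) * (b * b⁻¹)) ≈⟨ factor a b e b⁻¹ ⟩
      (a * a + e * (b * b)) * (b⁻¹ * b⁻¹)                  ≈⟨ *-congʳ a²+eb²≈0 ⟩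
      0# * (b⁻¹ * b⁻¹)                                     ≈⟨ zeroˡ (b⁻¹ * b⁻¹) ⟩
      0#                                                   ∎
      where
      factor : ∀ a b e v → (a * v) * (a * v) + e * ((b * v) * (b * v)) ≈ (a * a + e * (b * b)) * (v * v)
      factor = solve 4 (λ a b e v →
        (a :* v) :* (a :* v) :+ e :* ((b :* v) :* (b :* v)) := (a :* a :+ e :* (b :* b)) :* (v :* v)) refl

lemma2p3 : {c ℓ : Level} (m : ℕ) → 1 ≤ m →
    (F : CommutativeRing c ℓ) → IsFiniteFieldOfOrder (3 ^ m) F →
    let open CommutativeRing F in
    (x₁ x₂ x₃ c₁ c₂ c₃ : Carrier) →
    ¬ (x₁ ≈ 0#) → ¬ (x₂ ≈ 0#) → ¬ (x₃ ≈ 0#) →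
    ¬ (c₁ ≈ 0#) → ¬ (c₂ ≈ 0#) → ¬ (c₃ ≈ 0#) →
    ¬ ((x₁ ≈ x₂) × (c₁ * (x₁ * x₁) ≈ c₂ * (x₂ * x₂))) →
    ¬ ((x₁ ≈ x₃) × (c₁ * (x₁ * x₁) ≈ c₃ * (x₃ * x₃))) →
    ¬ ((x₂ ≈ x₃) × (c₂ * (x₂ * x₂) ≈ c₃ * (x₃ * x₃))) →
    x₁ + x₂ + x₃ ≈ 0# →
    c₁ * (x₁ * x₁) + c₂ * (x₂ * x₂) + c₃ * (x₃ * x₃) ≈ 0# →
    IsSquare F (- (c₁ * c₂ + c₁ * c₃ + c₂ * c₃))
lemma2p3 _ _ F isField x₁ x₂ x₃ c₁ c₂ c₃ _ x₂≉0 _ _ _ _ _ _ _ Σx≈0 Σcx²≈0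
  with x₂⁻¹ , x₂*x₂⁻¹≈1 ← IsFiniteFieldOfOrder.inverse isField x₂ x₂≉0 =
  a²+eb²≈0⇒-e-isSquare F ((c₁ + c₃) * x₁ + c₃ * x₂) x₂ (c₁ * c₂ + c₁ * c₃ + c₂ * c₃) x₂*x₂⁻¹≈1
    (completed-square≈0 F c₁ c₂ c₃ Σx≈0 Σcx²≈0)
  where open CommutativeRing F
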